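{- Let $V$ be a finite set, $d\ge2$, and let $E\subseteq\binom Vd$ be minimal. Then for every vertex $v\in V$, the link $\mathrm{lk}(v,E)\subseteq\binom V{d-1}$ is minimal (as a system of $(d-1)$-subsets of $V$).
   Context: For a system $E\subseteq\binom{V}{k}$ of $k$-element subsets of $V$, its coboundary $\delta E\subseteq\binom V{k+1}$ is the set of $(k+1)$-element subsets of $V$ containing an odd number of members of $E$. A system $E\subseteq\binom Vk$ is minimal if $|E|\le|E'|$ for every $E'\subseteq\binom Vk$ with $\delta E'=\delta E$ (minimality always refers to the fixed ground set $V$). For $v\in V$, the link is $\mathrm{lk}(v,E):=\{e\setminus\{v\}: e\in E,\ v\in e\}$. -}

module Defs where

open import Data.Bool using (Bool; true; false; _∧_; not)
open import Data.Nat using (ℕ; zero; suc; _≡ᵇ_; _≤_)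
open import Data.List using (List; []; _∷_; _++_; map; filterᵇ; length)
open import Data.Vec using (Vec; []; _∷_; lookup; _[_]≔_)
open import Data.Fin using (Fin)
open import Data.Fin.Subset using (Subset; inside; outside; ∣_∣; _⊆_)
open import Data.Fin.Subset.Properties using (_⊆?_)
open import Relation.Nullary.Decidable using (⌊_⌋)
open import Relation.Binary.PropositionalEquality using (_≡_)
open import Data.Product using (_×_)

allSubsets : (n : ℕ) → List (Subset n)
allSubsets zero = [] ∷ []
allSubsets (suc n) = map (outside ∷_) (allSubsets n) ++ map (inside ∷_) (allSubsets n)

System : ℕ → Set
System n = Subset n → Bool

IsSystem : ∀ {n} → ℕ → System n → Set
IsSystem k E = ∀ S → E S ≡ true → ∣ S ∣ ≡ k

card : ∀ {n} → System n → ℕ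
card {n} E = length (filterᵇ E (allSubsets n))

odd : ℕ → Bool
odd zero = false
odd (suc m) = not (odd m)

countBelow : ∀ {n} → ℕ → System n → Subset n → ℕ
countBelow {n} k E S =
  length (filterᵇ (λ T → E T ∧ (∣ T ∣ ≡ᵇ k) ∧ ⌊ T ⊆? S ⌋) (allSubsets n))

δ : ∀ {n} → ℕ → System n → System n
δ k E S = (∣ S ∣ ≡ᵇ suc k) ∧ odd (countBelow k E S)

Minimal : ∀ {n} → ℕ → System n → Set
Minimal {n} k E =
  IsSystem k E × (∀ (E' : System n) → IsSystem k E' → (∀ S → δ k E' S ≡ δ k E S) → card E ≤ card E')

-- lk(v,E) = { e ∖ {v} : e ∈ E, v ∈ e }, i.e. S ∈ lk(v,E) iff v ∉ S and S ∪ {v} ∈ E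
link : ∀ {n} → Fin n → System n → System n
link v E S with lookup S v
... | true = false
... | false = E (S [ v ]≔ inside)

-- Write G for E with its star at v replaced by the cone v ∗ F over a competitor F of lk(v,E).
-- Below a set S ∋ v, the members of a system containing v correspond to the members of its
-- link below S ∖ {v}, so δG = δE as soon as δF = δ lk(v,E); minimality of E then gives
-- |E| ≤ |G|, and cancelling the common part away from v leaves |lk(v,E)| ≤ |F|.
module Submission where

open import Defs
open import Algebra.Properties.CommutativeSemigroup using (interchange)
open import Data.Bool using (Bool; true; false; _∧_; not; _xor_; T)
open import Data.Bool.Properties using (∧-zeroʳ; not-distribˡ-xor)
open import Data.Fin using (Fin; zero; suc; _≟_)
open import Data.Fin.Subset using (Subset; inside; outside; ∣_∣; _⊆_; _∈_)
open import Data.Fin.Subset.Properties using (_⊆?_)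
open import Data.List using ([]; _∷_; _++_; map; filterᵇ; length)
open import Data.List.Properties using (length-++; filter-++; filter-≐; filter-none)
open import Data.List.Relation.Unary.All using (tabulate)
open import Data.Nat using (ℕ; suc; _+_; _≤_; _∸_; _≡ᵇ_)
open import Data.Nat.Properties
  using (+-identityʳ; +-cancelˡ-≤; +-monoʳ-≤; m≤m+n; suc-injective; +-commutativeSemigroup; module ≤-Reasoning)
open import Data.Product using (_,_)
open import Data.Vec using (_∷_; lookup; _[_]≔_)
open import Data.Vec.Properties
  using ([]≔-idempotent; []≔-lookup; []≔-minimal; lookup∘update; lookup∘update′; []=⇒lookup; lookup⇒[]=)
open import Function.Bundles using (_⇔_; mk⇔)
open import Relation.Nullary using (yes; no)
open import Relation.Nullary.Decidable using (Dec; ⌊_⌋; T?; toWitness; does-⇔; isYes≗does)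
open import Relation.Binary.PropositionalEquality
open import Function using (_∘_)

odd-+ : ∀ m n → odd (m + n) ≡ odd m xor odd n
odd-+ ℕ.zero n = refl
odd-+ (suc m) n = trans (cong not (odd-+ m n)) (not-distribˡ-xor (odd m) (odd n))

∧-xor-cong : ∀ c {x x′ y y′} → x ≡ x′ → c ∧ y ≡ c ∧ y′ → c ∧ (x xor y) ≡ c ∧ (x′ xor y′)
∧-xor-cong false x≡x′ cy≡cy′ = refl
∧-xor-cong true x≡x′ cy≡cy′ = cong₂ _xor_ x≡x′ cy≡cy′

guarded-∧-cong : ∀ {x y} c b → (T b → x ≡ y) → x ∧ (c ∧ b) ≡ y ∧ (c ∧ b)
guarded-∧-cong c true x≡y = cong (_∧ (c ∧ true)) (x≡y _)
guarded-∧-cong false false _ = trans (∧-zeroʳ _) (sym (∧-zeroʳ _))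
guarded-∧-cong true false _ = trans (∧-zeroʳ _) (sym (∧-zeroʳ _))

⌊⌋-⇔ : ∀ {a b} {A : Set a} {B : Set b} → A ⇔ B → (a? : Dec A) (b? : Dec B) → ⌊ a? ⌋ ≡ ⌊ b? ⌋
⌊⌋-⇔ A⇔B a? b? = trans (isYes≗does a?) (trans (does-⇔ A⇔B a? b?) (sym (isYes≗does b?)))

private variable n : ℕ

∣p[x]≔inside∣≡suc∣p∣ : ∀ (p : Subset n) x → lookup p x ≡ false → ∣ p [ x ]≔ inside ∣ ≡ suc ∣ p ∣
∣p[x]≔inside∣≡suc∣p∣ (outside ∷ p) zero _ = refl
∣p[x]≔inside∣≡suc∣p∣ (inside ∷ p) zero ()
∣p[x]≔inside∣≡suc∣p∣ (outside ∷ p) (suc x) x∉p = ∣p[x]≔inside∣≡suc∣p∣ p x x∉p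
∣p[x]≔inside∣≡suc∣p∣ (inside ∷ p) (suc x) x∉p = cong suc (∣p[x]≔inside∣≡suc∣p∣ p x x∉p)

[]≔-restore : ∀ (p : Subset n) x {b c} → lookup p x ≡ b → (p [ x ]≔ c) [ x ]≔ b ≡ p
[]≔-restore p x refl = trans ([]≔-idempotent p x) ([]≔-lookup p x)

∣p∣≡suc∣p[x]≔outside∣ : ∀ (p : Subset n) x → lookup p x ≡ true → ∣ p ∣ ≡ suc ∣ p [ x ]≔ outside ∣
∣p∣≡suc∣p[x]≔outside∣ p x x∈p = begin
  ∣ p ∣                                ≡⟨ cong ∣_∣ ([]≔-restore p x {c = outside} x∈p) ⟨
  ∣ (p [ x ]≔ outside) [ x ]≔ inside ∣ ≡⟨ ∣p[x]≔inside∣≡suc∣p∣ (p [ x ]≔ outside) x (lookup∘update x p outside) ⟩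
  suc ∣ p [ x ]≔ outside ∣             ∎
  where open ≡-Reasoning

∈-[]≔⁻ : ∀ {x y : Fin n} (p : Subset n) {b} → x ≢ y → x ∈ p [ y ]≔ b → x ∈ p
∈-[]≔⁻ p {b} x≢y x∈p′ = lookup⇒[]= _ p (trans (sym (lookup∘update′ x≢y p b)) ([]=⇒lookup x∈p′))

⊆-lookup : ∀ {p q : Subset n} {x} → p ⊆ q → lookup p x ≡ true → lookup q x ≡ true
⊆-lookup p⊆q x∈p = []=⇒lookup (p⊆q (lookup⇒[]= _ _ x∈p))

p[x]≔inside⊆q⇔p⊆q[x]≔outside : ∀ {p q : Subset n} {x} → lookup p x ≡ false → lookup q x ≡ true →
                               (p [ x ]≔ inside ⊆ q) ⇔ (p ⊆ q [ x ]≔ outside)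
p[x]≔inside⊆q⇔p⊆q[x]≔outside {p = p} {q} {x} x∉p x∈q = mk⇔ to from
  where
  to : p [ x ]≔ inside ⊆ q → p ⊆ q [ x ]≔ outside
  to p′⊆q {y} y∈p with y ≟ x
  ... | yes refl with () ← trans (sym ([]=⇒lookup y∈p)) x∉p
  ... | no y≢x = []≔-minimal q y x y≢x (p′⊆q ([]≔-minimal p y x y≢x y∈p))

  from : p ⊆ q [ x ]≔ outside → p [ x ]≔ inside ⊆ q
  from p⊆q′ {y} y∈p′ with y ≟ x
  ... | yes refl = lookup⇒[]= y q x∈q
  ... | no y≢x = ∈-[]≔⁻ q y≢x (p⊆q′ (∈-[]≔⁻ p y≢x y∈p′))

card-cong : {P Q : System n} → (∀ S → P S ≡ Q S) → card P ≡ card Q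
card-cong {n} {P} {Q} P≗Q =
  cong length (filter-≐ (T? ∘ P) (T? ∘ Q) (subst T (P≗Q _) , subst T (sym (P≗Q _))) (allSubsets n))

card-const-false : card {n} (λ _ → false) ≡ 0
card-const-false {n} = cong length (filter-none (λ _ → T? false) {allSubsets n} (tabulate λ _ ()))

length-filterᵇ-map : ∀ {A B : Set} (P : B → Bool) (f : A → B) xs →
                     length (filterᵇ P (map f xs)) ≡ length (filterᵇ (λ x → P (f x)) xs)
length-filterᵇ-map P f [] = refl
length-filterᵇ-map P f (x ∷ xs) with P (f x)
... | true = cong suc (length-filterᵇ-map P f xs)
... | false = length-filterᵇ-map P f xs

card-∷ : (P : System (suc n)) → card P ≡ card (λ S → P (outside ∷ S)) + card (λ S → P (inside ∷ S))
card-∷ {n} P = begin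
  length (filterᵇ P (map (outside ∷_) Ss ++ map (inside ∷_) Ss))
    ≡⟨ cong length (filter-++ (T? ∘ P) (map (outside ∷_) Ss) _) ⟩
  length (filterᵇ P (map (outside ∷_) Ss) ++ filterᵇ P (map (inside ∷_) Ss))
    ≡⟨ length-++ (filterᵇ P (map (outside ∷_) Ss)) ⟩
  length (filterᵇ P (map (outside ∷_) Ss)) + length (filterᵇ P (map (inside ∷_) Ss))
    ≡⟨ cong₂ _+_ (length-filterᵇ-map P (outside ∷_) Ss) (length-filterᵇ-map P (inside ∷_) Ss) ⟩
  card (λ S → P (outside ∷ S)) + card (λ S → P (inside ∷ S)) ∎
  where
  open ≡-Reasoning
  Ss = allSubsets n

deletion : Fin n → System n → System n
deletion v E S with lookup S v
... | true = false
... | false = E S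

deletion-∷ : ∀ (v : Fin n) E b S → deletion (suc v) E (b ∷ S) ≡ deletion v (λ S′ → E (b ∷ S′)) S
deletion-∷ v E b S with lookup S v
... | true = refl
... | false = refl

link-∷ : ∀ (v : Fin n) E b S → link (suc v) E (b ∷ S) ≡ link v (λ S′ → E (b ∷ S′)) S
link-∷ v E b S with lookup S v
... | true = refl
... | false = refl

card-split : ∀ (v : Fin n) E → card E ≡ card (deletion v E) + card (link v E)
card-split {suc n} zero E = begin
  card E
    ≡⟨ card-∷ E ⟩
  card E₀ + card E₁
    ≡⟨ cong₂ _+_ (+-identityʳ (card E₀)) (+-identityʳ (card E₁)) ⟨
  (card E₀ + 0) + (card E₁ + 0)
    ≡⟨ cong₂ (λ a b → (card E₀ + a) + (card E₁ + b)) (card-const-false {n}) (card-const-false {n}) ⟨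
  (card E₀ + card {n} (λ _ → false)) + (card E₁ + card {n} (λ _ → false))
    ≡⟨ cong₂ _+_ (card-∷ (deletion zero E)) (card-∷ (link zero E)) ⟨
  card (deletion zero E) + card (link zero E) ∎
  where
  open ≡-Reasoning
  E₀ E₁ : System n
  E₀ S = E (outside ∷ S)
  E₁ S = E (inside ∷ S)
card-split {suc n} (suc v) E = begin
  card E
    ≡⟨ card-∷ E ⟩
  card E₀ + card E₁
    ≡⟨ cong₂ _+_ (card-split v E₀) (card-split v E₁) ⟩
  (card (deletion v E₀) + card (link v E₀)) + (card (deletion v E₁) + card (link v E₁))
    ≡⟨ interchange +-commutativeSemigroup
         (card (deletion v E₀)) (card (link v E₀)) (card (deletion v E₁)) (card (link v E₁)) ⟩
  (card (deletion v E₀) + card (deletion v E₁)) + (card (link v E₀) + card (link v E₁))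
    ≡⟨ cong₂ _+_ (cong₂ _+_ (card-cong (deletion-∷ v E outside)) (card-cong (deletion-∷ v E inside)))
                 (cong₂ _+_ (card-cong (link-∷ v E outside)) (card-cong (link-∷ v E inside))) ⟨
  card (λ S → deletion (suc v) E (outside ∷ S)) + card (λ S → deletion (suc v) E (inside ∷ S))
    + (card (λ S → link (suc v) E (outside ∷ S)) + card (λ S → link (suc v) E (inside ∷ S)))
    ≡⟨ cong₂ _+_ (card-∷ (deletion (suc v) E)) (card-∷ (link (suc v) E)) ⟨
  card (deletion (suc v) E) + card (link (suc v) E) ∎
  where
  open ≡-Reasoning
  E₀ E₁ : System n
  E₀ S = E (outside ∷ S)
  E₁ S = E (inside ∷ S)

deletion-≡-below : ∀ {S T : Subset n} {v} E → T ⊆ S → lookup S v ≡ false → deletion v E T ≡ E T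
deletion-≡-below {T = T} {v} E T⊆S v∉S with lookup T v in v∈T
... | false = refl
... | true with () ← trans (sym (⊆-lookup T⊆S v∈T)) v∉S

below : ℕ → System n → Subset n → System n
below k E S T = E T ∧ ((∣ T ∣ ≡ᵇ k) ∧ ⌊ T ⊆? S ⌋)

countBelow-cong : ∀ k {P Q : System n} S → (∀ T → T ⊆ S → P T ≡ Q T) → countBelow k P S ≡ countBelow k Q S
countBelow-cong k S P≗Q = card-cong λ T → guarded-∧-cong _ ⌊ T ⊆? S ⌋ (λ T⊆S → P≗Q T (toWitness T⊆S))

countBelow-deletion : ∀ k (v : Fin n) E {S} → lookup S v ≡ false → countBelow k (deletion v E) S ≡ countBelow k E S
countBelow-deletion k v E {S} v∉S = countBelow-cong k S λ T T⊆S → deletion-≡-below E T⊆S v∉S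

countBelow-split : ∀ k (v : Fin n) E {S} → lookup S v ≡ true →
                   countBelow (suc k) E S ≡ countBelow (suc k) (deletion v E) S + countBelow k (link v E) (S [ v ]≔ outside)
countBelow-split k v E {S} v∈S =
  trans (card-split v (below (suc k) E S)) (cong₂ _+_ (card-cong deletion-of-below) (card-cong link-of-below))
  where
  deletion-of-below : ∀ T → deletion v (below (suc k) E S) T ≡ below (suc k) (deletion v E) S T
  deletion-of-below T with lookup T v
  ... | true = refl
  ... | false = refl

  link-of-below : ∀ T → link v (below (suc k) E S) T ≡ below k (link v E) (S [ v ]≔ outside) T
  link-of-below T with lookup T v in v∉T
  ... | true = refl
  ... | false = cong₂ (λ m b → E (T [ v ]≔ inside) ∧ ((m ≡ᵇ suc k) ∧ b))
                      (∣p[x]≔inside∣≡suc∣p∣ T v v∉T)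
                      (⌊⌋-⇔ (p[x]≔inside⊆q⇔p⊆q[x]≔outside v∉T v∈S) _ _)

δ-cong : ∀ k {P Q : System n} {S} → countBelow k P S ≡ countBelow k Q S → δ k P S ≡ δ k Q S
δ-cong k {S = S} = cong λ c → (∣ S ∣ ≡ᵇ suc k) ∧ odd c

δ-suc-split : ∀ k (v : Fin n) E {S} → lookup S v ≡ true →
              δ (suc k) E S ≡ (∣ S [ v ]≔ outside ∣ ≡ᵇ suc k) ∧
                              (odd (countBelow (suc k) (deletion v E) S) xor odd (countBelow k (link v E) (S [ v ]≔ outside)))
δ-suc-split k v E {S} v∈S = trans
  (cong₂ (λ m c → (m ≡ᵇ suc (suc k)) ∧ odd c)
         (∣p∣≡suc∣p[x]≔outside∣ S v v∈S) (countBelow-split k v E v∈S))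
  (cong ((∣ S [ v ]≔ outside ∣ ≡ᵇ suc k) ∧_)
        (odd-+ (countBelow (suc k) (deletion v E) S) (countBelow k (link v E) (S [ v ]≔ outside))))

δ-suc-cong : ∀ k (v : Fin n) G E → (∀ T → deletion v G T ≡ deletion v E T) →
             (∀ S → lookup S v ≡ false → δ k (link v G) S ≡ δ k (link v E) S) →
             ∀ S → δ (suc k) G S ≡ δ (suc k) E S
δ-suc-cong k v G E del≗ δlk≡ S with lookup S v in v∈S
... | false = δ-cong (suc k) {G} {E} {S} (begin
  countBelow (suc k) G S              ≡⟨ countBelow-deletion (suc k) v G v∈S ⟨
  countBelow (suc k) (deletion v G) S ≡⟨ countBelow-cong (suc k) S (λ T _ → del≗ T) ⟩
  countBelow (suc k) (deletion v E) S ≡⟨ countBelow-deletion (suc k) v E v∈S ⟩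
  countBelow (suc k) E S              ∎)
  where open ≡-Reasoning
... | true = trans (δ-suc-split k v G v∈S) (trans
  (∧-xor-cong _ (cong odd (countBelow-cong (suc k) S (λ T _ → del≗ T))) (δlk≡ _ (lookup∘update v S outside)))
  (sym (δ-suc-split k v E v∈S)))

replaceLink : Fin n → System n → System n → System n
replaceLink v F E S with lookup S v
... | true = F (S [ v ]≔ outside)
... | false = E S

module _ (v : Fin n) (F E : System n) where

  deletion-replaceLink : ∀ T → deletion v (replaceLink v F E) T ≡ deletion v E T
  deletion-replaceLink T with lookup T v in v∉T
  ... | true = refl
  ... | false rewrite v∉T = refl

  link-replaceLink : ∀ T → link v (replaceLink v F E) T ≡ deletion v F T
  link-replaceLink T with lookup T v in v∉T
  ... | true = refl
  ... | false rewrite lookup∘update v T inside = cong F ([]≔-restore T v v∉T)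

  card-replaceLink : card (replaceLink v F E) ≡ card (deletion v E) + card (deletion v F)
  card-replaceLink = trans (card-split v (replaceLink v F E))
                           (cong₂ _+_ (card-cong deletion-replaceLink) (card-cong link-replaceLink))

  replaceLink-system : ∀ k → IsSystem k F → IsSystem (suc k) E → IsSystem (suc k) (replaceLink v F E)
  replaceLink-system k F-sys E-sys S S∈G with lookup S v in v∈S
  ... | true = trans (∣p∣≡suc∣p[x]≔outside∣ S v v∈S) (cong suc (F-sys _ S∈G))
  ... | false = E-sys S S∈G

  δ-replaceLink : ∀ k → (∀ S → δ k F S ≡ δ k (link v E) S) →
                  ∀ S → δ (suc k) (replaceLink v F E) S ≡ δ (suc k) E S
  δ-replaceLink k δF≡ = δ-suc-cong k v (replaceLink v F E) E deletion-replaceLink λ S v∉S →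
    trans (δ-cong k {link v (replaceLink v F E)} {F} {S}
                  (trans (countBelow-cong k S (λ T _ → link-replaceLink T)) (countBelow-deletion k v F v∉S)))
          (δF≡ S)

link-system : ∀ k (v : Fin n) {E} → IsSystem (suc k) E → IsSystem k (link v E)
link-system k v {E} E-sys S S∈lk with lookup S v in v∉S
... | false = suc-injective (trans (sym (∣p[x]≔inside∣≡suc∣p∣ S v v∉S)) (E-sys _ S∈lk))

minimal-link : ∀ k (E : System n) → Minimal (suc k) E → (v : Fin n) → Minimal k (link v E)
minimal-link k E (E-sys , E-min) v = link-system k v E-sys , link-min
  where
  link-min : ∀ F → IsSystem k F → (∀ S → δ k F S ≡ δ k (link v E) S) → card (link v E) ≤ card F
  link-min F F-sys δF≡ = +-cancelˡ-≤ (card (deletion v E)) _ _ (begin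
    card (deletion v E) + card (link v E)    ≡⟨ card-split v E ⟨
    card E                                   ≤⟨ E-min (replaceLink v F E) (replaceLink-system v F E k F-sys E-sys)
                                                      (δ-replaceLink v F E k δF≡) ⟩
    card (replaceLink v F E)                 ≡⟨ card-replaceLink v F E ⟩
    card (deletion v E) + card (deletion v F) ≤⟨ +-monoʳ-≤ (card (deletion v E)) (m≤m+n _ _) ⟩
    card (deletion v E) + (card (deletion v F) + card (link v F)) ≡⟨ cong (card (deletion v E) +_) (card-split v F) ⟨
    card (deletion v E) + card F             ∎)
    where open ≤-Reasoning

mainTheorem5 : (n d : ℕ) → 2 ≤ d → (E : System n) → Minimal d E →
    (v : Fin n) → Minimal (d ∸ 1) (link v E)
mainTheorem5 n (suc d) _ E E-min v = minimal-link d E E-min v
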